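{- Let $(X,\mathcal{F})$ be a Subset Avoider-Enforcer game (with a fixed player moving first), and let $a,b\in X$ be vertices such that $L(a)\prec L(b)$. If a player (Avoider or Enforcer) has a winning strategy, then she also has a winning strategy in which she always prefers claiming $a$ over claiming $b$, i.e., she never claims $b$ on her move while $a$ is still unclaimed.
   Context: A Subset Avoider-Enforcer game consists of a finite board $X$ and a family $\mathcal{F}$ of losing pairs $(f,i_f)$ with $f\subseteq X$ and $i_f\in\mathbb{N}$. Avoider and Enforcer alternately claim one previously unclaimed element of $X$ per move until all elements are claimed. Avoider loses (Enforcer wins) if for some $(f,i_f)\in\mathcal{F}$ Avoider has claimed at least $i_f$ elements of $f$; otherwise Avoider wins. For $v\in X$, let $L(v)=\{(f,i_f)\in\mathcal{F} : v\in f\}$. We write $L(a)\prec L(b)$ if for every pair $(f,i_f)\in L(a)$ there is a pair $(g,i_g)\in L(b)$ with $g\subseteq f$ and $i_g\le i_f$. -}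

module Defs where

open import Data.Nat using (ℕ; zero; suc; _≤_; _<_)
open import Data.Fin using (Fin)
open import Data.Fin.Subset using (Subset; _∈_; _⊆_)
open import Data.Fin.Subset.Properties using (_∈?_)
open import Data.List using (List; []; _∷_; _++_; length; filter)
open import Data.List.Membership.Propositional using () renaming (_∈_ to _∈ₗ_)
open import Data.List.Relation.Unary.Unique.Propositional using (Unique)
open import Data.Product using (Σ; _×_; _,_; ∃-syntax)
open import Data.Sum using (_⊎_)
open import Relation.Nullary using (¬_)
open import Relation.Binary.PropositionalEquality using (_≡_; _≢_)

data Player : Set where
  Avoider Enforcer : Player

other : Player → Player
other Avoider  = Enforcer
other Enforcer = Avoider

-- A Subset Avoider-Enforcer game on the board X = Fin n:
-- a finite family (list) of losing pairs (f , i_f), f ⊆ X, i_f ∈ ℕ.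
Family : ℕ → Set
Family n = List (Subset n × ℕ)

_≺⟨_⟩_ : ∀ {n} → Fin n → Family n → Fin n → Set
a ≺⟨ F ⟩ b = ∀ f i → (f , i) ∈ₗ F → a ∈ f →
  ∃[ g ] ∃[ j ] ((g , j) ∈ₗ F × b ∈ g × g ⊆ f × j ≤ i)

moverAt : Player → ℕ → Player
moverAt first zero    = first
moverAt first (suc k) = other (moverAt first k)

-- A history is the list of claimed elements, in the order claimed.
-- A strategy maps each history to the element to claim next.
Strategy : ℕ → Set
Strategy n = List (Fin n) → Fin n

Legal : ∀ {n} → Player → Player → Strategy n → Set
Legal {n} first P σ = ∀ (h : List (Fin n)) → Unique h → length h < n →
  moverAt first (length h) ≡ P → ¬ (σ h ∈ₗ h)

IsPlay : ∀ {n} → List (Fin n) → Set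
IsPlay {n} p = Unique p × length p ≡ n

Consistent : ∀ {n} → Player → Player → Strategy n → List (Fin n) → Set
Consistent {n} first P σ p = ∀ (h : List (Fin n)) (x : Fin n) (t : List (Fin n)) →
  p ≡ h ++ x ∷ t → moverAt first (length h) ≡ P → x ≡ σ h

-- Elements claimed by player P in a play, where m is the player to move at its start.
claimsOf : ∀ {n} → Player → Player → List (Fin n) → List (Fin n)
claimsOf P m [] = []
claimsOf Avoider  Avoider  (x ∷ xs) = x ∷ claimsOf Avoider Enforcer xs
claimsOf Avoider  Enforcer (x ∷ xs) = claimsOf Avoider Avoider xs
claimsOf Enforcer Avoider  (x ∷ xs) = claimsOf Enforcer Enforcer xs
claimsOf Enforcer Enforcer (x ∷ xs) = x ∷ claimsOf Enforcer Avoider xs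

AvoiderLoses : ∀ {n} → Family n → Player → List (Fin n) → Set
AvoiderLoses F first p = ∃[ f ] ∃[ i ] ((f , i) ∈ₗ F ×
  i ≤ length (filter (_∈? f) (claimsOf Avoider first p)))

Wins : ∀ {n} → Family n → Player → Player → List (Fin n) → Set
Wins F first Avoider  p = ¬ AvoiderLoses F first p
Wins F first Enforcer p = AvoiderLoses F first p

WinningStrategy : ∀ {n} → Family n → Player → Player → Strategy n → Set
WinningStrategy F first P σ = Legal first P σ ×
  (∀ p → IsPlay p → Consistent first P σ p → Wins F first P p)

Prefers : ∀ {n} → Player → Player → Strategy n → Fin n → Fin n → Set
Prefers {n} first P σ a b = ∀ (h : List (Fin n)) → Unique h → length h < n →
  moverAt first (length h) ≡ P → ¬ (a ∈ₗ h) → σ h ≢ b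

-- Let σ win for P. The strategy σ′ follows σ until σ would first claim b while a is still
-- free; there it claims a instead, and from then on it answers as σ would in the play with
-- a and b interchanged. A play following σ′ either never makes this swap, and then follows σ,
-- or it is the a ↔ b mirror image of a play following σ, which P wins. Since every losing set
-- containing a also contains b, interchanging a and b in Avoider's claims cannot lower her
-- count in any losing set when she holds a (P = Avoider), and cannot raise it when she does
-- not (P = Enforcer); so P also wins the original play.
module Submission where

open import Defs
open import Algebra.Properties.CommutativeSemigroup using (interchange)
open import Data.Bool using (true; false; if_then_else_)
open import Data.Empty using (⊥-elim)
open import Data.Fin using (Fin; _≟_)
open import Data.Fin.Permutation.Components using (transpose)
open import Data.Fin.Subset using (Subset; _∈_; _∉_)
open import Data.Fin.Subset.Properties using (_∈?_)
open import Data.List using (List; []; _∷_; _++_; length; filter; map)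
open import Data.List.Properties
  using (∷-injectiveˡ; ∷-injectiveʳ; ++-assoc; length-++; length-map; map-++; map-∘; map-cong; map-id; map-id-local; filter-some; filter-none)
open import Data.List.Membership.Propositional using () renaming (_∈_ to _∈ₗ_; _∉_ to _∉ₗ_)
open import Data.List.Membership.Propositional.Properties using (∈-map⁺; ∈-++⁺ˡ; ∈-++⁺ʳ)
open import Data.List.Relation.Binary.Sublist.Propositional using ([]; _∷_; _∷ʳ_; ⊆-refl) renaming (_⊆_ to _⊑_)
open import Data.List.Relation.Binary.Sublist.Propositional.Properties using (All-resp-⊆; Any-resp-⊆; ++⁺; ++⁺ʳ)
open import Data.List.Relation.Unary.All as All using (All; []; _∷_)
open import Data.List.Relation.Unary.All.Properties using (¬Any⇒All¬)
open import Data.List.Relation.Unary.Any using (here; there)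
open import Data.List.Relation.Unary.Unique.Propositional using (Unique; []; _∷_)
open import Data.List.Relation.Unary.Unique.Propositional.Properties using (Unique[x∷xs]⇒x∉xs; map⁺)
open import Data.Nat using (ℕ; zero; suc; _+_; _≤_; _<_; z≤n; s≤s)
open import Data.Nat.Properties using (+-commutativeSemigroup; +-cancelʳ-≡; +-cancelʳ-≤; +-identityʳ; ≤-reflexive; ≤-trans; m≤m+n; m<m+n; +-monoʳ-≤; module ≤-Reasoning)
open import Data.Product using (_×_; _,_; ∃; ∃₂; ∃-syntax; proj₁; proj₂)
open import Data.Sum using (_⊎_; inj₁; inj₂; [_,_]′)
open import Function using (_∘_)
open import Relation.Binary.Definitions using (DecidableEquality)
open import Relation.Binary.PropositionalEquality
open import Relation.Nullary using (¬_; Dec; yes; no; does)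
open import Relation.Nullary.Decidable using (dec-true; dec-false; _×-dec_)
open import Relation.Unary using (Pred; Decidable)

module _ {A : Set} where

  ∉-∷ : ∀ {x y : A} {xs} → x ≢ y → x ∉ₗ xs → x ∉ₗ y ∷ xs
  ∉-∷ x≢y _    (here x≡y)   = x≢y x≡y
  ∉-∷ _   x∉xs (there x∈xs) = x∉xs x∈xs

  Unique-resp-⊑ : ∀ {xs ys : List A} → xs ⊑ ys → Unique ys → Unique xs
  Unique-resp-⊑ []         []       = []
  Unique-resp-⊑ (_ ∷ʳ xs⊑ys) (_ ∷ u)  = Unique-resp-⊑ xs⊑ys u
  Unique-resp-⊑ (refl ∷ xs⊑ys) (y∉ ∷ u) = All-resp-⊆ xs⊑ys y∉ ∷ Unique-resp-⊑ xs⊑ys u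

  Unique[xs++x∷ys]⇒x∉xs++ys : ∀ xs {x : A} {ys} → Unique (xs ++ x ∷ ys) → x ∉ₗ xs ++ ys
  Unique[xs++x∷ys]⇒x∉xs++ys []       u                = Unique[x∷xs]⇒x∉xs u
  Unique[xs++x∷ys]⇒x∉xs++ys (y ∷ xs) (y∉ ∷ _) (here refl) = All.lookup y∉ (∈-++⁺ʳ xs (here refl)) refl
  Unique[xs++x∷ys]⇒x∉xs++ys (y ∷ xs) (_ ∷ u)  (there x∈)  = Unique[xs++x∷ys]⇒x∉xs++ys xs u x∈

  first-split : DecidableEquality A → ∀ x xs →
                x ∉ₗ xs ⊎ ∃₂ λ ys zs → xs ≡ ys ++ x ∷ zs × x ∉ₗ ys
  first-split _≟ᴬ_ x [] = inj₁ λ ()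
  first-split _≟ᴬ_ x (y ∷ xs) with x ≟ᴬ y | first-split _≟ᴬ_ x xs
  ... | yes refl | _                          = inj₂ ([] , xs , refl , λ ())
  ... | no x≢y   | inj₁ x∉xs                  = inj₁ (∉-∷ x≢y x∉xs)
  ... | no x≢y   | inj₂ (ys , zs , refl , x∉ys) = inj₂ (y ∷ ys , zs , refl , ∉-∷ x≢y x∉ys)

  first-split-unique : ∀ {x : A} ys ys′ {zs zs′} → x ∉ₗ ys → x ∉ₗ ys′ →
                       ys ++ x ∷ zs ≡ ys′ ++ x ∷ zs′ → ys ≡ ys′
  first-split-unique []       []         _   _    _  = refl
  first-split-unique []       (y′ ∷ ys′) _   x∉′ eq = ⊥-elim (x∉′ (here (∷-injectiveˡ eq)))
  first-split-unique (y ∷ ys) []         x∉  _   eq = ⊥-elim (x∉ (here (sym (∷-injectiveˡ eq))))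
  first-split-unique (y ∷ ys) (y′ ∷ ys′) x∉  x∉′ eq =
    cong₂ _∷_ (∷-injectiveˡ eq) (first-split-unique ys ys′ (x∉ ∘ there) (x∉′ ∘ there) (∷-injectiveʳ eq))

  ∉-prefix : ∀ {x : A} ys {ws} zs {vs} → x ∉ₗ ys → ys ++ ws ≡ zs ++ x ∷ vs → ∃ λ rs → zs ≡ ys ++ rs
  ∉-prefix []       zs       _  _  = zs , refl
  ∉-prefix (y ∷ ys) []       x∉ eq = ⊥-elim (x∉ (here (sym (∷-injectiveˡ eq))))
  ∉-prefix (y ∷ ys) (z ∷ zs) x∉ eq with ∉-prefix ys zs (x∉ ∘ there) (∷-injectiveʳ eq)
  ... | rs , refl = rs , cong (_∷ ys ++ rs) (sym (∷-injectiveˡ eq))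

  count : ∀ {ℓ} {P : Pred A ℓ} → Decidable P → List A → ℕ
  count P? xs = length (filter P? xs)

  indicator : ∀ {ℓ} {P : Pred A ℓ} → Decidable P → A → ℕ
  indicator P? x = if does (P? x) then 1 else 0

  module _ {ℓ} {P : Pred A ℓ} (P? : Decidable P) where

    count-∷ : ∀ x xs → count P? (x ∷ xs) ≡ indicator P? x + count P? xs
    count-∷ x xs with does (P? x)
    ... | true  = refl
    ... | false = refl

    indicator-yes : ∀ {x} → P x → indicator P? x ≡ 1
    indicator-yes {x} px rewrite dec-true (P? x) px = refl

    indicator-no : ∀ {x} → ¬ P x → indicator P? x ≡ 0
    indicator-no {x} ¬px rewrite dec-false (P? x) ¬px = refl

    indicator-cong : ∀ {x y} → (P x → P y) → (P y → P x) → indicator P? x ≡ indicator P? y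
    indicator-cong {x} {y} x⇒y y⇒x with P? x
    ... | yes px = sym (indicator-yes (x⇒y px))
    ... | no ¬px = sym (indicator-no (¬px ∘ y⇒x))

  module _ {ℓ} {P Q R : Pred A ℓ} (P? : Decidable P) (Q? : Decidable Q) (R? : Decidable R) (g : A → A)
           (balanced : ∀ x → indicator P? (g x) + indicator Q? x ≡ indicator P? x + indicator R? x) where
    open ≡-Reasoning

    count-map-balance : ∀ xs → count P? (map g xs) + count Q? xs ≡ count P? xs + count R? xs
    count-map-balance []       = refl
    count-map-balance (x ∷ xs) = begin
      count P? (g x ∷ map g xs) + count Q? (x ∷ xs)
        ≡⟨ cong₂ _+_ (count-∷ P? (g x) (map g xs)) (count-∷ Q? x xs) ⟩
      (indicator P? (g x) + count P? (map g xs)) + (indicator Q? x + count Q? xs)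
        ≡⟨ interchange +-commutativeSemigroup (indicator P? (g x)) _ (indicator Q? x) _ ⟩
      (indicator P? (g x) + indicator Q? x) + (count P? (map g xs) + count Q? xs)
        ≡⟨ cong₂ _+_ (balanced x) (count-map-balance xs) ⟩
      (indicator P? x + indicator R? x) + (count P? xs + count R? xs)
        ≡⟨ interchange +-commutativeSemigroup (indicator P? x) _ (count P? xs) _ ⟩
      (indicator P? x + count P? xs) + (indicator R? x + count R? xs)
        ≡⟨ sym (cong₂ _+_ (count-∷ P? x xs) (count-∷ R? x xs)) ⟩
      count P? (x ∷ xs) + count R? (x ∷ xs) ∎

module _ {A : Set} (_≟ᴬ_ : DecidableEquality A) where

  count-≟-∉ : ∀ {x} {xs} → x ∉ₗ xs → count (x ≟ᴬ_) xs ≡ 0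
  count-≟-∉ {xs = xs} x∉ = cong length (filter-none (_ ≟ᴬ_) (¬Any⇒All¬ xs x∉))

  count-≟-Unique : ∀ x {xs} → Unique xs → count (x ≟ᴬ_) xs ≤ 1
  count-≟-Unique x {[]}     []       = z≤n
  count-≟-Unique x {y ∷ xs} (y∉ ∷ u) with x ≟ᴬ y
  ... | yes refl = s≤s (≤-reflexive (cong length (filter-none (x ≟ᴬ_) y∉)))
  ... | no _     = count-≟-Unique x u

module _ {n} (i j : Fin n) where

  transpose-matchˡ : transpose i j i ≡ j
  transpose-matchˡ rewrite dec-true (i ≟ i) refl = refl

  transpose-matchʳ : transpose i j j ≡ i
  transpose-matchʳ with j ≟ i
  ... | yes j≡i = j≡i
  ... | no _ rewrite dec-true (j ≟ j) refl = refl

  transpose-other : ∀ {k} → k ≢ i → k ≢ j → transpose i j k ≡ k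
  transpose-other {k} k≢i k≢j rewrite dec-false (k ≟ i) k≢i | dec-false (k ≟ j) k≢j = refl

  transpose-involutive : ∀ k → transpose i j (transpose i j k) ≡ k
  transpose-involutive k = by-cases (k ≟ i) (k ≟ j)
    where
    by-cases : Dec (k ≡ i) → Dec (k ≡ j) → transpose i j (transpose i j k) ≡ k
    by-cases (yes refl) _        = trans (cong (transpose i j) transpose-matchˡ) transpose-matchʳ
    by-cases (no _)     (yes refl) = trans (cong (transpose i j) transpose-matchʳ) transpose-matchˡ
    by-cases (no k≢i)   (no k≢j)   = trans (cong (transpose i j) (transpose-other k≢i k≢j)) (transpose-other k≢i k≢j)

  transpose-injective : ∀ {k l} → transpose i j k ≡ transpose i j l → k ≡ l
  transpose-injective {k} {l} eq =
    trans (sym (transpose-involutive k)) (trans (cong (transpose i j) eq) (transpose-involutive l))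

  map-transpose-involutive : ∀ xs → map (transpose i j) (map (transpose i j) xs) ≡ xs
  map-transpose-involutive xs =
    trans (sym (map-∘ xs)) (trans (map-cong transpose-involutive xs) (map-id xs))

  map-transpose-fixed : ∀ {xs} → i ∉ₗ xs → j ∉ₗ xs → map (transpose i j) xs ≡ xs
  map-transpose-fixed i∉xs j∉xs = map-id-local (All.tabulate λ k∈xs →
    transpose-other (λ k≡i → i∉xs (subst (_∈ₗ _) k≡i k∈xs)) (λ k≡j → j∉xs (subst (_∈ₗ _) k≡j k∈xs)))

_≟ₚ_ : DecidableEquality Player
Avoider  ≟ₚ Avoider  = yes refl
Avoider  ≟ₚ Enforcer = no λ ()
Enforcer ≟ₚ Avoider  = no λ ()
Enforcer ≟ₚ Enforcer = yes refl

moverAt-other : ∀ m k → moverAt (other m) k ≡ other (moverAt m k)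
moverAt-other m zero    = refl
moverAt-other m (suc k) = cong other (moverAt-other m k)

module _ {n : ℕ} where

  claimsOf-++ : ∀ Q m (h r : List (Fin n)) →
                claimsOf Q m (h ++ r) ≡ claimsOf Q m h ++ claimsOf Q (moverAt m (length h)) r
  claimsOf-++ Q        m        []      r = refl
  claimsOf-++ Avoider  Avoider  (x ∷ h) r
    rewrite claimsOf-++ Avoider Enforcer h r | moverAt-other Avoider (length h) = refl
  claimsOf-++ Avoider  Enforcer (x ∷ h) r
    rewrite claimsOf-++ Avoider Avoider h r | moverAt-other Enforcer (length h) = refl
  claimsOf-++ Enforcer Avoider  (x ∷ h) r
    rewrite claimsOf-++ Enforcer Enforcer h r | moverAt-other Avoider (length h) = refl
  claimsOf-++ Enforcer Enforcer (x ∷ h) r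
    rewrite claimsOf-++ Enforcer Avoider h r | moverAt-other Enforcer (length h) = refl

  claimsOf-map : ∀ (g : Fin n → Fin n) Q m l → claimsOf Q m (map g l) ≡ map g (claimsOf Q m l)
  claimsOf-map g Q        m        []      = refl
  claimsOf-map g Avoider  Avoider  (x ∷ l) = cong (g x ∷_) (claimsOf-map g Avoider Enforcer l)
  claimsOf-map g Avoider  Enforcer (x ∷ l) = claimsOf-map g Avoider Avoider l
  claimsOf-map g Enforcer Avoider  (x ∷ l) = claimsOf-map g Enforcer Enforcer l
  claimsOf-map g Enforcer Enforcer (x ∷ l) = cong (g x ∷_) (claimsOf-map g Enforcer Avoider l)

  claimsOf-⊑ : ∀ Q m (l : List (Fin n)) → claimsOf Q m l ⊑ l
  claimsOf-⊑ Q        m        []      = []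
  claimsOf-⊑ Avoider  Avoider  (x ∷ l) = refl ∷ claimsOf-⊑ Avoider Enforcer l
  claimsOf-⊑ Avoider  Enforcer (x ∷ l) = x ∷ʳ claimsOf-⊑ Avoider Avoider l
  claimsOf-⊑ Enforcer Avoider  (x ∷ l) = x ∷ʳ claimsOf-⊑ Enforcer Enforcer l
  claimsOf-⊑ Enforcer Enforcer (x ∷ l) = refl ∷ claimsOf-⊑ Enforcer Avoider l

  claimsOf-self : ∀ Q (x : Fin n) t → x ∈ₗ claimsOf Q Q (x ∷ t)
  claimsOf-self Avoider  x t = here refl
  claimsOf-self Enforcer x t = here refl

  claimsOf-skip : ∀ {Q m} → m ≢ Q → ∀ (x : Fin n) t → claimsOf Q m (x ∷ t) ⊑ t
  claimsOf-skip {Avoider}  {Avoider}  m≢Q = ⊥-elim (m≢Q refl)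
  claimsOf-skip {Avoider}  {Enforcer} _   x t = claimsOf-⊑ Avoider Avoider t
  claimsOf-skip {Enforcer} {Avoider}  _   x t = claimsOf-⊑ Enforcer Enforcer t
  claimsOf-skip {Enforcer} {Enforcer} m≢Q = ⊥-elim (m≢Q refl)

  ∈-claimsOf : ∀ Q m h (x : Fin n) t → moverAt m (length h) ≡ Q → x ∈ₗ claimsOf Q m (h ++ x ∷ t)
  ∈-claimsOf Q m h x t refl rewrite claimsOf-++ Q m h (x ∷ t) =
    ∈-++⁺ʳ (claimsOf Q m h) (claimsOf-self (moverAt m (length h)) x t)

  ∉-claimsOf : ∀ Q m h (x : Fin n) t → Unique (h ++ x ∷ t) → moverAt m (length h) ≢ Q →
               x ∉ₗ claimsOf Q m (h ++ x ∷ t)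
  ∉-claimsOf Q m h x t u m≢Q x∈ = Unique[xs++x∷ys]⇒x∉xs++ys h u (Any-resp-⊆ claims⊑h++t x∈′)
    where
    x∈′ : x ∈ₗ claimsOf Q m h ++ claimsOf Q (moverAt m (length h)) (x ∷ t)
    x∈′ = subst (x ∈ₗ_) (claimsOf-++ Q m h (x ∷ t)) x∈
    claims⊑h++t : claimsOf Q m h ++ claimsOf Q (moverAt m (length h)) (x ∷ t) ⊑ h ++ t
    claims⊑h++t = ++⁺ (claimsOf-⊑ Q m h) (claimsOf-skip m≢Q x t)

module _ {n} {a b : Fin n} (f : Subset n) where
  private
    τ : Fin n → Fin n
    τ = transpose a b

  count-transpose-invariant : (a ∈ f → b ∈ f) → (b ∈ f → a ∈ f) →
                              ∀ xs → count (_∈? f) (map τ xs) ≡ count (_∈? f) xs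
  count-transpose-invariant a⇒b b⇒a xs =
    +-cancelʳ-≡ (count (_∈? f) xs) _ _
      (count-map-balance (_∈? f) (_∈? f) (_∈? f) τ (λ x → cong (_+ _) (invariant x (x ≟ a) (x ≟ b))) xs)
    where
    invariant : ∀ x → Dec (x ≡ a) → Dec (x ≡ b) → indicator (_∈? f) (τ x) ≡ indicator (_∈? f) x
    invariant x (yes refl) _ rewrite transpose-matchˡ a b = indicator-cong (_∈? f) b⇒a a⇒b
    invariant x (no _) (yes refl) rewrite transpose-matchʳ a b = indicator-cong (_∈? f) a⇒b b⇒a
    invariant x (no x≢a) (no x≢b) rewrite transpose-other a b x≢a x≢b = refl

  module _ (a≢b : a ≢ b) where

    count-transpose-shift : a ∉ f → b ∈ f →
      ∀ xs → count (_∈? f) (map τ xs) + count (b ≟_) xs ≡ count (_∈? f) xs + count (a ≟_) xs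
    count-transpose-shift a∉f b∈f =
      count-map-balance (_∈? f) (b ≟_) (a ≟_) τ (λ x → shift x (x ≟ a) (x ≟ b))
      where
      shift : ∀ x → Dec (x ≡ a) → Dec (x ≡ b) →
              indicator (_∈? f) (τ x) + indicator (b ≟_) x ≡ indicator (_∈? f) x + indicator (a ≟_) x
      shift x (yes refl) _
        rewrite transpose-matchˡ a b | indicator-yes (_∈? f) b∈f | indicator-no (b ≟_) (a≢b ∘ sym)
              | indicator-no (_∈? f) a∉f | indicator-yes (a ≟_) refl = refl
      shift x (no _) (yes refl)
        rewrite transpose-matchʳ a b | indicator-no (_∈? f) a∉f | indicator-yes (b ≟_) refl
              | indicator-yes (_∈? f) b∈f | indicator-no (a ≟_) a≢b = refl
      shift x (no x≢a) (no x≢b)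
        rewrite transpose-other a b x≢a x≢b | indicator-no (b ≟_) (x≢b ∘ sym)
              | indicator-no (a ≟_) (x≢a ∘ sym) = refl

    count-transpose-cases : (a ∈ f → b ∈ f) →
      (∀ xs → count (_∈? f) (map τ xs) ≡ count (_∈? f) xs) ⊎
      (∀ xs → count (_∈? f) (map τ xs) + count (b ≟_) xs ≡ count (_∈? f) xs + count (a ≟_) xs)
    count-transpose-cases a⇒b with a ∈? f | b ∈? f
    ... | yes a∈f | _       = inj₁ (count-transpose-invariant a⇒b (λ _ → a∈f))
    ... | no a∉f  | yes b∈f = inj₂ (count-transpose-shift a∉f b∈f)
    ... | no a∉f  | no b∉f  = inj₁ (count-transpose-invariant a⇒b (⊥-elim ∘ b∉f))

    open ≤-Reasoning

    count-transpose-≤ : (a ∈ f → b ∈ f) → ∀ {xs} → Unique xs → a ∈ₗ xs →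
                        count (_∈? f) xs ≤ count (_∈? f) (map τ xs)
    count-transpose-≤ a⇒b {xs} u a∈xs with count-transpose-cases a⇒b
    ... | inj₁ invariant = ≤-reflexive (sym (invariant xs))
    ... | inj₂ shift     = +-cancelʳ-≤ 1 _ _ (begin
      count (_∈? f) xs + 1               ≤⟨ +-monoʳ-≤ (count (_∈? f) xs) (filter-some (a ≟_) a∈xs) ⟩
      count (_∈? f) xs + count (a ≟_) xs ≡⟨ sym (shift xs) ⟩
      count (_∈? f) (map τ xs) + count (b ≟_) xs
        ≤⟨ +-monoʳ-≤ (count (_∈? f) (map τ xs)) (count-≟-Unique _≟_ b u) ⟩
      count (_∈? f) (map τ xs) + 1       ∎)

    count-transpose-≥ : (a ∈ f → b ∈ f) → ∀ {xs} → a ∉ₗ xs →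
                        count (_∈? f) (map τ xs) ≤ count (_∈? f) xs
    count-transpose-≥ a⇒b {xs} a∉xs with count-transpose-cases a⇒b
    ... | inj₁ invariant = ≤-reflexive (invariant xs)
    ... | inj₂ shift     = begin
      count (_∈? f) (map τ xs)                   ≤⟨ m≤m+n _ (count (b ≟_) xs) ⟩
      count (_∈? f) (map τ xs) + count (b ≟_) xs ≡⟨ shift xs ⟩
      count (_∈? f) xs + count (a ≟_) xs         ≡⟨ cong (count (_∈? f) xs +_) (count-≟-∉ _≟_ a∉xs) ⟩
      count (_∈? f) xs + 0                       ≡⟨ +-identityʳ _ ⟩
      count (_∈? f) xs                           ∎

-- The only consequence of L(a) ≺ L(b) that the argument needs.
_≼⟨_⟩_ : ∀ {n} → Fin n → Family n → Fin n → Set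
a ≼⟨ F ⟩ b = ∀ f i → (f , i) ∈ₗ F → a ∈ f → b ∈ f

≺⇒≼ : ∀ {n} {F : Family n} {a b} → a ≺⟨ F ⟩ b → a ≼⟨ F ⟩ b
≺⇒≼ a≺b f i mem a∈f with a≺b f i mem a∈f
... | _ , _ , _ , b∈g , g⊆f , _ = g⊆f b∈g

module _ {n} {F : Family n} {first : Player} {a b : Fin n} (a≢b : a ≢ b) (a≼b : a ≼⟨ F ⟩ b) where

  wins-transpose : ∀ u v → Unique (u ++ a ∷ v) → ∀ Q → moverAt first (length u) ≡ Q →
                   Wins F first Q (map (transpose a b) (u ++ a ∷ v)) → Wins F first Q (u ++ a ∷ v)
  wins-transpose u v uniq Avoider mv avoids (f , i , mem , i≤)
    rewrite claimsOf-map (transpose a b) Avoider first (u ++ a ∷ v) =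
    avoids (f , i , mem , ≤-trans i≤ (count-transpose-≤ f a≢b (a≼b f i mem)
      (Unique-resp-⊑ (claimsOf-⊑ Avoider first _) uniq) (∈-claimsOf Avoider first u a v mv)))
  wins-transpose u v uniq Enforcer mv (f , i , mem , i≤)
    rewrite claimsOf-map (transpose a b) Avoider first (u ++ a ∷ v) =
    f , i , mem , ≤-trans i≤ (count-transpose-≥ f a≢b (a≼b f i mem)
      (∉-claimsOf Avoider first u a v uniq λ mv′ → Enforcer≢Avoider (trans (sym mv) mv′)))
    where
    Enforcer≢Avoider : Enforcer ≢ Avoider
    Enforcer≢Avoider ()

module Preferring {n} (first P : Player) (a b : Fin n) (σ : Strategy n) where
  private
    τ : Fin n → Fin n
    τ = transpose a b

  Trigger : List (Fin n) → Set
  Trigger u = moverAt first (length u) ≡ P × σ u ≡ b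

  trigger? : ∀ u → Dec (Trigger u)
  trigger? u = (moverAt first (length u) ≟ₚ P) ×-dec (σ u ≟ b)

  redirect : Fin n → Fin n
  redirect y = if does (y ≟ b) then a else y

  redirect-b : redirect b ≡ a
  redirect-b rewrite dec-true (b ≟ b) refl = refl

  redirect-other : ∀ {y} → y ≢ b → redirect y ≡ y
  redirect-other {y} y≢b rewrite dec-false (y ≟ b) y≢b = refl

  redirect-cases : ∀ y → redirect y ≡ a ⊎ redirect y ≡ y
  redirect-cases y with y ≟ b
  ... | yes _ = inj₁ refl
  ... | no _  = inj₂ refl

  redirect-≢b : a ≢ b → ∀ y → redirect y ≢ b
  redirect-≢b a≢b y with y ≟ b
  ... | yes _   = a≢b
  ... | no y≢b = y≢b

  σ′ : Strategy n
  σ′ h with first-split _≟_ a h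
  ... | inj₁ _       = redirect (σ h)
  ... | inj₂ (u , _) = if does (trigger? u) then τ (σ (map τ h)) else σ h

  σ′-fresh : ∀ {h} → a ∉ₗ h → σ′ h ≡ redirect (σ h)
  σ′-fresh {h} a∉h with first-split _≟_ a h
  ... | inj₁ _                  = refl
  ... | inj₂ (u , v , refl , _) = ⊥-elim (a∉h (∈-++⁺ʳ u (here refl)))

  σ′-after : ∀ u v → a ∉ₗ u →
             σ′ (u ++ a ∷ v) ≡ (if does (trigger? u) then τ (σ (map τ (u ++ a ∷ v))) else σ (u ++ a ∷ v))
  σ′-after u v a∉u with first-split _≟_ a (u ++ a ∷ v)
  ... | inj₁ a∉                      = ⊥-elim (a∉ (∈-++⁺ʳ u (here refl)))
  ... | inj₂ (u′ , v′ , eq , a∉u′)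
    rewrite first-split-unique u′ u a∉u′ a∉u (sym eq) = refl

  σ′-swapped : ∀ {u} v → a ∉ₗ u → Trigger u → σ′ (u ++ a ∷ v) ≡ τ (σ (map τ (u ++ a ∷ v)))
  σ′-swapped {u} v a∉u tr rewrite σ′-after u v a∉u | dec-true (trigger? u) tr = refl

  σ′-unswapped : ∀ {u} v → a ∉ₗ u → ¬ Trigger u → σ′ (u ++ a ∷ v) ≡ σ (u ++ a ∷ v)
  σ′-unswapped {u} v a∉u ¬tr rewrite σ′-after u v a∉u | dec-false (trigger? u) ¬tr = refl

  data Response (h : List (Fin n)) : Set where
    fresh     : a ∉ₗ h → σ′ h ≡ redirect (σ h) → Response h
    swapped   : σ′ h ≡ τ (σ (map τ h)) → Response h
    unswapped : σ′ h ≡ σ h → Response h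

  response : ∀ h → Response h
  response h with first-split _≟_ a h
  ... | inj₁ a∉h = fresh a∉h (σ′-fresh a∉h)
  ... | inj₂ (u , v , refl , a∉u) with trigger? u
  ...   | yes tr = swapped (σ′-swapped v a∉u tr)
  ...   | no ¬tr = unswapped (σ′-unswapped v a∉u ¬tr)

  legal′ : Legal first P σ → Legal first P σ′
  legal′ legal h u len mv σ′h∈h with response h
  ... | fresh a∉h e with redirect-cases (σ h)
  ...   | inj₁ r≡a = a∉h (subst (_∈ₗ h) (trans e r≡a) σ′h∈h)
  ...   | inj₂ r≡y = legal h u len mv (subst (_∈ₗ h) (trans e r≡y) σ′h∈h)
  legal′ legal h u len mv σ′h∈h | swapped e =
    legal (map τ h) (map⁺ (transpose-injective a b) u) (subst (_< n) (sym (length-map τ h)) len)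
      (trans (cong (moverAt first) (length-map τ h)) mv)
      (subst (_∈ₗ map τ h) (transpose-involutive a b _) (∈-map⁺ τ (subst (_∈ₗ h) e σ′h∈h)))
  legal′ legal h u len mv σ′h∈h | unswapped e = legal h u len mv (subst (_∈ₗ h) e σ′h∈h)

  prefers′ : a ≢ b → Prefers first P σ′ a b
  prefers′ a≢b h _ _ _ a∉h σ′h≡b = redirect-≢b a≢b (σ h) (trans (sym (σ′-fresh a∉h)) σ′h≡b)

  -- The first a of the play was claimed by σ′ in place of b.
  Deviates : List (Fin n) → Set
  Deviates p = ∃₂ λ u v → p ≡ u ++ a ∷ v × a ∉ₗ u × Trigger u

  deviates? : ∀ p → Dec (Deviates p)
  deviates? p with first-split _≟_ a p
  ... | inj₁ a∉p = no λ { (u , v , refl , _) → a∉p (∈-++⁺ʳ u (here refl)) }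
  ... | inj₂ (u , v , refl , a∉u) with trigger? u
  ...   | yes tr = yes (u , v , refl , a∉u , tr)
  ...   | no ¬tr = no λ { (u′ , v′ , eq , a∉u′ , tr′) →
                          ¬tr (subst Trigger (first-split-unique u′ u a∉u′ a∉u (sym eq)) tr′) }

  consistent-unless-deviates : ∀ p → ¬ Deviates p → Consistent first P σ′ p → Consistent first P σ p
  consistent-unless-deviates p ¬dev cons h x t refl mv with first-split _≟_ a h
  ... | inj₁ a∉h with σ h ≟ b
  ...   | yes σh≡b = ⊥-elim (¬dev (h , t , cong (λ y → h ++ y ∷ t) x≡a , a∉h , mv , σh≡b))
    where x≡a : x ≡ a
          x≡a = trans (cons h x t refl mv) (trans (σ′-fresh a∉h) (trans (cong redirect σh≡b) redirect-b))
  ...   | no σh≢b  = trans (cons h x t refl mv) (trans (σ′-fresh a∉h) (redirect-other σh≢b))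
  consistent-unless-deviates _ ¬dev cons _ x t refl mv | inj₂ (u , v , refl , a∉u) =
    trans (cons (u ++ a ∷ v) x t refl mv) (σ′-unswapped v a∉u λ tr →
      ¬dev (u , v ++ x ∷ t , ++-assoc u (a ∷ v) (x ∷ t) , a∉u , tr))

  module Deviation (legal : Legal first P σ) {u v} (play : IsPlay (u ++ a ∷ v))
                   (cons : Consistent first P σ′ (u ++ a ∷ v)) (a∉u : a ∉ₗ u) (tr : Trigger u) where
    private
      p : List (Fin n)
      p = u ++ a ∷ v

    b∉u : b ∉ₗ u
    b∉u b∈u = legal u unique-u length-u (proj₁ tr) (subst (_∈ₗ u) (sym (proj₂ tr)) b∈u)
      where
      unique-u : Unique u
      unique-u = Unique-resp-⊑ (++⁺ʳ (a ∷ v) ⊆-refl) (proj₁ play)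
      length-u : length u < n
      length-u = subst (length u <_) (trans (sym (length-++ u)) (proj₂ play)) (m<m+n (length u) (s≤s z≤n))

    mirrored-after : ∀ {h w s} r → h ≡ w ++ a ∷ s → a ∉ₗ w → p ≡ h ++ r → τ (σ′ h) ≡ σ (map τ h)
    mirrored-after {w = w} {s} r refl a∉w p≡
      rewrite first-split-unique w u a∉w a∉u (trans (sym (++-assoc w (a ∷ s) r)) (sym p≡)) =
      trans (cong τ (σ′-swapped s a∉u tr)) (transpose-involutive a b _)

    mirrored-fresh : ∀ {h} r → a ∉ₗ h → p ≡ h ++ σ′ h ∷ r → τ (σ′ h) ≡ σ (map τ h)
    mirrored-fresh {h} r a∉h p≡ = begin
      τ (σ′ h)           ≡⟨ cong τ (σ′-fresh a∉h) ⟩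
      τ (redirect (σ h)) ≡⟨ by-cases (σ h ≟ b) ⟩
      σ h                ≡⟨ cong σ (sym (map-transpose-fixed a b a∉h b∉h)) ⟩
      σ (map τ h)        ∎
      where
      open ≡-Reasoning
      b∉h : b ∉ₗ h
      b∉h b∈h with ∉-prefix h u a∉h (sym p≡)
      ... | _ , refl = b∉u (∈-++⁺ˡ b∈h)
      by-cases : Dec (σ h ≡ b) → τ (redirect (σ h)) ≡ σ h
      by-cases (yes σh≡b) = begin
        τ (redirect (σ h)) ≡⟨ cong (τ ∘ redirect) σh≡b ⟩
        τ (redirect b)     ≡⟨ cong τ redirect-b ⟩
        τ a                ≡⟨ transpose-matchˡ a b ⟩
        b                  ≡⟨ sym σh≡b ⟩
        σ h                ∎
      by-cases (no σh≢b) = trans (cong τ (redirect-other σh≢b)) (transpose-other a b σh≢a σh≢b)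
        where
        -- Otherwise σ′ would claim the first a of p at h, so h = u, where σ answers b.
        σh≢a : σ h ≢ a
        σh≢a σh≡a = σh≢b (subst (λ w → σ w ≡ b) (sym h≡u) (proj₂ tr))
          where
          p≡′ : p ≡ h ++ a ∷ r
          p≡′ = subst (λ y → p ≡ h ++ y ∷ r) (trans (σ′-fresh a∉h) (trans (redirect-other σh≢b) σh≡a)) p≡
          h≡u : h ≡ u
          h≡u = first-split-unique h u a∉h a∉u (sym p≡′)

    mirrored-play : IsPlay (map τ p)
    mirrored-play = map⁺ (transpose-injective a b) (proj₁ play) , trans (length-map τ p) (proj₂ play)

    mirrored-consistent : Consistent first P σ (map τ p)
    mirrored-consistent h x t eq mv = begin
      x                   ≡⟨ sym (transpose-involutive a b x) ⟩
      τ (τ x)             ≡⟨ cong τ x-response ⟩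
      τ (σ′ (map τ h))    ≡⟨ mirrored-response (subst (λ y → p ≡ map τ h ++ y ∷ map τ t) x-response p≡) ⟩
      σ (map τ (map τ h)) ≡⟨ cong σ (map-transpose-involutive a b h) ⟩
      σ h                 ∎
      where
      open ≡-Reasoning
      p≡ : p ≡ map τ h ++ τ x ∷ map τ t
      p≡ = trans (sym (map-transpose-involutive a b p)) (trans (cong (map τ) eq) (map-++ τ h (x ∷ t)))
      x-response : τ x ≡ σ′ (map τ h)
      x-response = cons (map τ h) (τ x) (map τ t) p≡ (trans (cong (moverAt first) (length-map τ h)) mv)
      mirrored-response : p ≡ map τ h ++ σ′ (map τ h) ∷ map τ t → τ (σ′ (map τ h)) ≡ σ (map τ (map τ h))
      mirrored-response p≡′ =
        [ (λ a∉ → mirrored-fresh _ a∉ p≡′) , (λ (_ , _ , h≡ , a∉w) → mirrored-after _ h≡ a∉w p≡′) ]′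
          (first-split _≟_ a (map τ h))

  winning′ : a ≢ b → ∀ {F} → a ≼⟨ F ⟩ b → WinningStrategy F first P σ → WinningStrategy F first P σ′
  winning′ a≢b {F} a≼b (legal , wins) = legal′ legal , wins′
    where
    wins′ : ∀ p → IsPlay p → Consistent first P σ′ p → Wins F first P p
    wins′ p play cons with deviates? p
    ... | no ¬dev = wins p play (consistent-unless-deviates p ¬dev cons)
    ... | yes (u , v , refl , a∉u , tr) =
      wins-transpose a≢b a≼b u v (proj₁ play) P (proj₁ tr) (wins _ mirrored-play mirrored-consistent)
      where open Deviation legal play cons a∉u tr

lemma2 : ∀ {n} (F : Family n) (first P : Player) (a b : Fin n) →
    a ≢ b → a ≺⟨ F ⟩ b →
    (∃[ σ ] WinningStrategy F first P σ) →
    ∃[ σ ] (WinningStrategy F first P σ × Prefers first P σ a b)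
lemma2 F first P a b a≢b a≺b (σ , winning) =
  σ′ , winning′ a≢b (≺⇒≼ a≺b) winning , prefers′ a≢b
  where open Preferring first P a b σ
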